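{- Let $w\in S_n$ and $\alpha=\mathsf{code}(w)$. Then for $1\leqslant i<j\leqslant n$, $$c_{i,j}(\alpha)=\#\{k: i<k<j\text{ and } w(k)<w(i)\}.$$ Moreover, $c_{i,n+1}(\alpha)=\alpha_i$ for every $i\in[n]$.
   Context: $S_n$ is the symmetric group on $[n]=\{1,\dots,n\}$. The code of $w\in S_n$ is $\mathsf{code}(w)=(\alpha_1,\dots,\alpha_{n-1})$ with $\alpha_i=\#\{k>i:w(k)<w(i)\}$; by convention $\alpha_k=0$ for $k\geqslant n$. For a composition $\alpha$ (finite sequence of nonnegative integers, extended by zeros), a positive integer $i$ and $j\in\mathbb{N}$: $c_{i,j}(\alpha)=0$ if $j\leqslant i+1$; for $j>i+1$, $c_{i,j}(\alpha)=c_{i,j-1}(\alpha)+1$ if $\alpha_{j-1}<\alpha_i-c_{i,j-1}(\alpha)$ and $c_{i,j}(\alpha)=c_{i,j-1}(\alpha)$ otherwise. -}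

module Defs where

open import Data.Nat using (ℕ; zero; suc; _+_; _∸_; _<_; _<ᵇ_; _≤ᵇ_)
open import Data.Nat.Properties using (_<?_)
open import Data.Bool using (Bool; true; false; if_then_else_; _∧_)
open import Data.Fin using (Fin; toℕ; fromℕ<)
open import Data.Fin.Permutation using (Permutation′; _⟨$⟩ʳ_)
open import Relation.Nullary using (yes; no)
open import Data.List using (List; length; filterᵇ; upTo)

-- Positions and values are 1-based as in the paper: w(k) for k ∈ [n] is
-- encoded via a permutation of Fin n; only relative order of values matters.
-- Outside [n] we return 0 (never used by the statement).
perm : {n : ℕ} → Permutation′ n → ℕ → ℕ
perm {n} w zero = 0
perm {n} w (suc k) with k <? n
... | yes k<n = suc (toℕ (w ⟨$⟩ʳ fromℕ< k<n))
... | no _ = 0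

countBelow : {n : ℕ} → Permutation′ n → (i lo hi : ℕ) → ℕ
countBelow w i lo hi =
  length (filterᵇ (λ k → (lo <ᵇ k) ∧ (perm w k <ᵇ perm w i)) (upTo hi))

-- A composition: an infinite sequence of naturals (1-indexed; index 0 unused),
-- i.e. a finite sequence extended by zeros.
Composition : Set
Composition = ℕ → ℕ

code : {n : ℕ} → Permutation′ n → Composition
code {n} w i = if (1 ≤ᵇ i) ∧ (i <ᵇ n) then countBelow w i i (suc n) else 0

-- c_{i,j}(α): 0 if j ≤ i+1; otherwise c_{i,j-1} + 1 if α_{j-1} < α_i - c_{i,j-1},
-- else c_{i,j-1}.  (Truncated subtraction agrees with the integer comparison
-- since α_{j-1} ≥ 0.)
c : ℕ → ℕ → Composition → ℕ
c i zero α = 0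
c i (suc j) α =
  if suc i <ᵇ suc j
  then (if α j <ᵇ (α i ∸ c i j α) then suc (c i j α) else c i j α)
  else 0

-- Fix i and let P k mean w(k) < w(i).  By induction on j, c_{i,j}(α) counts the
-- k ∈ (i, j) with P k, so α_i − c_{i,j}(α) = [P j] + #{k > j : P k}.  If P j, every
-- k > j with w(k) < w(j) satisfies P k, hence α_j < α_i − c_{i,j}(α); otherwise
-- w(i) ≤ w(j), every k > j with P k has w(k) < w(j), hence α_j ≥ α_i − c_{i,j}(α).
-- So the test in the recursion for c holds exactly when P j.
module Submission where

open import Defs
open import Data.Nat using (ℕ; zero; suc; _≤_; _<_; _+_; _∸_; _<ᵇ_; z≤n; s≤s)
open import Data.Nat.Properties
open import Data.Product using (_×_; _,_)
open import Data.Bool using (Bool; true; false; T; _∧_; if_then_else_)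
open import Data.Bool.Properties using (T-≡)
open import Data.Sum using (inj₁; inj₂)
open import Data.Unit using (tt)
open import Data.List using (_++_; [_]; length; filterᵇ; upTo)
open import Data.List.Properties using (upTo-∷ʳ; length-++; filter-++)
open import Data.Fin.Permutation using (Permutation′)
open import Function using (_∘_)
open import Function.Bundles using (Equivalence)
open import Relation.Binary.PropositionalEquality hiding ([_])
open import Relation.Nullary using (contradiction; yes; no)

indicator : Bool → ℕ
indicator true = 1
indicator false = 0

indicator-mono : ∀ {a b} → (T a → T b) → indicator a ≤ indicator b
indicator-mono {false} _ = z≤n
indicator-mono {true} {true} _ = ≤-refl
indicator-mono {true} {false} a⇒b = contradiction (a⇒b tt) λ ()

<ᵇ-true : ∀ {m n} → m < n → (m <ᵇ n) ≡ true
<ᵇ-true = Equivalence.to T-≡ ∘ <⇒<ᵇ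

<ᵇ-false : ∀ {m n} → n ≤ m → (m <ᵇ n) ≡ false
<ᵇ-false {m} {n} n≤m with m <ᵇ n in eq
... | false = refl
... | true = contradiction (<ᵇ⇒< m n (subst T (sym eq) tt)) (≤⇒≯ n≤m)

count : (ℕ → Bool) → ℕ → ℕ
count f zero = 0
count f (suc hi) = count f hi + indicator (f hi)

length-filterᵇ-upTo : ∀ f hi → length (filterᵇ f (upTo hi)) ≡ count f hi
length-filterᵇ-upTo f zero = refl
length-filterᵇ-upTo f (suc hi) = begin
  length (filterᵇ f (upTo (suc hi)))
    ≡⟨ cong (length ∘ filterᵇ f) (sym (upTo-∷ʳ hi)) ⟩
  length (filterᵇ f (upTo hi ++ [ hi ]))
    ≡⟨ cong length (filter-++ _ (upTo hi) [ hi ]) ⟩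
  length (filterᵇ f (upTo hi) ++ filterᵇ f [ hi ])
    ≡⟨ length-++ (filterᵇ f (upTo hi)) ⟩
  length (filterᵇ f (upTo hi)) + length (filterᵇ f [ hi ])
    ≡⟨ cong₂ _+_ (length-filterᵇ-upTo f hi) length-filterᵇ-singleton ⟩
  count f hi + indicator (f hi)
    ∎
  where
  open ≡-Reasoning
  length-filterᵇ-singleton : length (filterᵇ f [ hi ]) ≡ indicator (f hi)
  length-filterᵇ-singleton with f hi
  ... | true = refl
  ... | false = refl

countBetween : (ℕ → Bool) → ℕ → ℕ → ℕ
countBetween P lo = count (λ k → (lo <ᵇ k) ∧ P k)

countBetween-empty : ∀ P {lo} hi → hi ≤ suc lo → countBetween P lo hi ≡ 0
countBetween-empty P zero _ = refl
countBetween-empty P {lo} (suc hi) (s≤s hi≤lo)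
  rewrite countBetween-empty P hi (m≤n⇒m≤1+n hi≤lo) | <ᵇ-false {lo} {hi} hi≤lo = refl

countBetween-suc : ∀ P {lo hi} → lo < hi →
  countBetween P lo (suc hi) ≡ countBetween P lo hi + indicator (P hi)
countBetween-suc P lo<hi rewrite <ᵇ-true lo<hi = refl

countBetween-split : ∀ P {lo m} hi → lo ≤ m → m < hi →
  countBetween P lo hi ≡ countBetween P lo (suc m) + countBetween P m hi
countBetween-split P {lo} {m} (suc hi) lo≤m (s≤s m≤hi) with m≤n⇒m<n∨m≡n m≤hi
... | inj₂ refl rewrite countBetween-empty P {m} (suc m) ≤-refl = sym (+-identityʳ _)
... | inj₁ m<hi = begin
  countBetween P lo (suc hi)
    ≡⟨ countBetween-suc P (≤-<-trans lo≤m m<hi) ⟩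
  countBetween P lo hi + indicator (P hi)
    ≡⟨ cong (_+ indicator (P hi)) (countBetween-split P hi lo≤m m<hi) ⟩
  countBetween P lo (suc m) + countBetween P m hi + indicator (P hi)
    ≡⟨ +-assoc (countBetween P lo (suc m)) _ _ ⟩
  countBetween P lo (suc m) + (countBetween P m hi + indicator (P hi))
    ≡⟨ cong (countBetween P lo (suc m) +_) (countBetween-suc P m<hi) ⟨
  countBetween P lo (suc m) + countBetween P m (suc hi)
    ∎
  where open ≡-Reasoning

countBetween-∸ : ∀ P {lo j hi} → lo < j → j < hi →
  countBetween P lo hi ∸ countBetween P lo j ≡ indicator (P j) + countBetween P j hi
countBetween-∸ P {lo} {suc m} {hi} (s≤s lo≤m) j<hi = begin
  countBetween P lo hi ∸ countBetween P lo (suc m)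
    ≡⟨ cong (_∸ countBetween P lo (suc m)) (countBetween-split P hi lo≤m (<⇒≤ j<hi)) ⟩
  countBetween P lo (suc m) + countBetween P m hi ∸ countBetween P lo (suc m)
    ≡⟨ m+n∸m≡n (countBetween P lo (suc m)) _ ⟩
  countBetween P m hi
    ≡⟨ countBetween-split P hi (n≤1+n m) j<hi ⟩
  countBetween P m (suc (suc m)) + countBetween P (suc m) hi
    ≡⟨ cong (_+ countBetween P (suc m) hi) first-element ⟩
  indicator (P (suc m)) + countBetween P (suc m) hi
    ∎
  where
  open ≡-Reasoning
  first-element : countBetween P m (suc (suc m)) ≡ indicator (P (suc m))
  first-element rewrite countBetween-suc P (n<1+n m) | countBetween-empty P {m} (suc m) ≤-refl = refl

countBetween-mono : ∀ {P Q} lo hi → (∀ k → T (P k) → T (Q k)) →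
  countBetween P lo hi ≤ countBetween Q lo hi
countBetween-mono lo zero _ = z≤n
countBetween-mono lo (suc hi) P⇒Q =
  +-mono-≤ (countBetween-mono lo hi P⇒Q) (indicator-mono (restrict (P⇒Q hi)))
  where
  restrict : ∀ {a b c} → (T b → T c) → T (a ∧ b) → T (a ∧ c)
  restrict {true} b⇒c = b⇒c

below : (ℕ → ℕ) → ℕ → ℕ → Bool
below p i k = p k <ᵇ p i

countBetween-below-comparison : ∀ p {i j} lo hi →
  (countBetween (below p j) lo hi <ᵇ indicator (below p i j) + countBetween (below p i) lo hi)
    ≡ below p i j
countBetween-below-comparison p {i} {j} lo hi with below p i j in pj<pi
... | true = <ᵇ-true (s≤s (countBetween-mono lo hi below-j⇒below-i))
  where
  below-j⇒below-i : ∀ k → T (below p j k) → T (below p i k)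
  below-j⇒below-i k pk<pj =
    <⇒<ᵇ (<-trans (<ᵇ⇒< (p k) (p j) pk<pj) (<ᵇ⇒< (p j) (p i) (subst T (sym pj<pi) tt)))
... | false = <ᵇ-false (countBetween-mono lo hi below-i⇒below-j)
  where
  below-i⇒below-j : ∀ k → T (below p i k) → T (below p j k)
  below-i⇒below-j k pk<pi =
    <⇒<ᵇ (<-≤-trans (<ᵇ⇒< (p k) (p i) pk<pi) (≮⇒≥ (subst T pj<pi ∘ <⇒<ᵇ)))

c-below-diagonal : ∀ {i} j α → j ≤ suc i → c i j α ≡ 0
c-below-diagonal zero α _ = refl
c-below-diagonal {i} (suc j) α (s≤s j≤i) rewrite <ᵇ-false {i} {j} j≤i = refl

c-step : ∀ {i j} α → i < j → c i (suc j) α ≡ c i j α + indicator (α j <ᵇ α i ∸ c i j α)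
c-step {i} {j} α i<j rewrite <ᵇ-true i<j with α j <ᵇ α i ∸ c i j α
... | true = sym (+-comm (c i j α) 1)
... | false = sym (+-identityʳ (c i j α))

module _ {n : ℕ} (w : Permutation′ n) where

  countBelow-countBetween : ∀ i lo hi → countBelow w i lo hi ≡ countBetween (below (perm w) i) lo hi
  countBelow-countBetween i lo hi = length-filterᵇ-upTo _ hi

  code-countBetween : ∀ {i} → 1 ≤ i → i ≤ n → code w i ≡ countBetween (below (perm w) i) i (suc n)
  code-countBetween {suc i} _ i≤n with m≤n⇒m<n∨m≡n i≤n
  ... | inj₁ i<n =
    trans (cong (λ b → if b then countBelow w (suc i) (suc i) (suc n) else 0) (<ᵇ-true i<n))
          (countBelow-countBetween (suc i) (suc i) (suc n))
  ... | inj₂ refl =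
    trans (cong (λ b → if b then countBelow w n n (suc n) else 0) (<ᵇ-false {n} ≤-refl))
          (sym (countBetween-empty _ (suc n) ≤-refl))

  c-code-countBetween : ∀ {i} j → 1 ≤ i → j ≤ suc n →
    c i j (code w) ≡ countBetween (below (perm w) i) i j
  c-code-countBetween zero _ _ = refl
  c-code-countBetween {i} (suc j) 1≤i sj≤sn with i <? j
  ... | no i≮j = trans (c-below-diagonal (suc j) (code w) (s≤s (≮⇒≥ i≮j)))
                       (sym (countBetween-empty _ (suc j) (s≤s (≮⇒≥ i≮j))))
  ... | yes i<j = begin
    c i (suc j) α                               ≡⟨ c-step α i<j ⟩
    c i j α + indicator (α j <ᵇ α i ∸ c i j α)  ≡⟨ cong (λ t → t + indicator (α j <ᵇ α i ∸ t)) c≡s ⟩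
    s + indicator (α j <ᵇ α i ∸ s)              ≡⟨ cong (λ b → s + indicator b) test≡below ⟩
    s + indicator (below p i j)                 ≡⟨ countBetween-suc _ i<j ⟨
    countBetween (below p i) i (suc j)          ∎
    where
    open ≡-Reasoning
    p : ℕ → ℕ
    p = perm w
    α : Composition
    α = code w
    s : ℕ
    s = countBetween (below p i) i j
    j≤n : j ≤ n
    j≤n = ≤-pred sj≤sn
    c≡s : c i j α ≡ s
    c≡s = c-code-countBetween j 1≤i (m≤n⇒m≤1+n j≤n)
    test≡below : (α j <ᵇ α i ∸ s) ≡ below p i j
    test≡below = begin
      α j <ᵇ α i ∸ s
        ≡⟨ cong₂ (λ a b → a <ᵇ b ∸ s) (code-countBetween (≤-trans 1≤i (<⇒≤ i<j)) j≤n)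
                                       (code-countBetween 1≤i (<⇒≤ (<-≤-trans i<j j≤n))) ⟩
      countBetween (below p j) j (suc n) <ᵇ countBetween (below p i) i (suc n) ∸ s
        ≡⟨ cong (countBetween (below p j) j (suc n) <ᵇ_) (countBetween-∸ _ i<j (s≤s j≤n)) ⟩
      countBetween (below p j) j (suc n) <ᵇ indicator (below p i j) + countBetween (below p i) j (suc n)
        ≡⟨ countBetween-below-comparison p {i} {j} j (suc n) ⟩
      below p i j
        ∎

lemma4p1 : (n : ℕ) (w : Permutation′ n) →
    ((i j : ℕ) → 1 ≤ i → i < j → j ≤ n →
    c i j (code w) ≡ countBelow w i i j)
    × ((i : ℕ) → 1 ≤ i → i ≤ n → c i (suc n) (code w) ≡ code w i)
lemma4p1 n w =
  (λ i j 1≤i _ j≤n → trans (c-code-countBetween w j 1≤i (m≤n⇒m≤1+n j≤n))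
                           (sym (countBelow-countBetween w i i j))) ,
  (λ i 1≤i i≤n → trans (c-code-countBetween w (suc n) 1≤i ≤-refl)
                       (sym (code-countBetween w 1≤i i≤n)))
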